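{- For every $k\ge1$, with $d=\lfloor\log_2(k+1)\rfloor$, the amortized U-MMB proof size $\bar\sigma_{\mathrm{U\text{ - }MMB}}(k):=\lim_{N\to\infty}\frac1N\sum_{n=k}^{k+N-1}\sigma_{\mathrm{U\text{ - }MMB}}(k,n)$ equals $$\bar\sigma_{\mathrm{U\text{ - }MMB}}(k)=\begin{cases} d+\dfrac{3(k+1)}{2^{d+1}}-2 & \text{if } 2^d\le k+1<\frac32 2^d,\\[2mm] d+\dfrac{k+1}{2^{d+1}}-\dfrac12 & \text{if } \frac32 2^d\le k+1<2^{d+1}.\end{cases}$$
   Context: A mountain of height $s\ge0$ is a perfect binary tree with $2^s$ leaves; its root is its peak. The U-MMB with $n$ leaves is an ordered (left-to-right) list of mountains whose leaves read left to right are $h_1,\dots,h_n$, built inductively from the empty list: the $n$-th append (1) adds $h_n$ as a height-0 mountain at the right end, and (2) if there exist two consecutive mountains of equal height, takes the rightmost such pair, of height $s$, and replaces it in place by a mountain of height $s+1$ whose new peak has the two old peaks as children. For $1\le k\le n$, $\sigma_{\mathrm{U\text{ - }MMB}}(k,n)$ is the number of hashes in the membership proof of $h_{n-k+1}$ (siblings of the nodes on its path up to, excluding, its peak), which equals the height of the mountain containing $h_{n-k+1}$. -}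

module Defs where

open import Data.Nat using (ℕ; zero; suc; _+_; _*_; _∸_; _^_; _<?_; _≟_)
open import Data.Nat.ListAction using (sum)
open import Data.Nat.Properties using (m^n≢0)
open import Data.List using (List; []; _∷_; map; upTo)
open import Data.Integer using (+_)
open import Data.Rational using (ℚ; _/_; _-_; ∣_∣; _<_; 0ℚ)
open import Data.Product using (∃-syntax)
open import Relation.Nullary using (yes; no)

-- A U-MMB is represented by the list of the heights of its mountains,
-- stored RIGHT-TO-LEFT (head = rightmost mountain).

mergeFrom : ℕ → List ℕ → List ℕ
mergeFrom a []         = a ∷ []
mergeFrom a (b ∷ rest) with a ≟ b
... | yes _ = suc a ∷ rest
... | no  _ = a ∷ mergeFrom b rest

mergeRev : List ℕ → List ℕ
mergeRev []       = []
mergeRev (a ∷ xs) = mergeFrom a xs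

-- U-MMB with n leaves (right-to-left heights), built from the empty list:
-- each append (1) adds a height-0 mountain at the right end, (2) merges once.
ummbRev : ℕ → List ℕ
ummbRev zero    = []
ummbRev (suc n) = mergeRev (0 ∷ ummbRev n)

-- Height of the mountain containing the leaf at 0-based position q counted
-- from the RIGHT end (a mountain of height s covers 2^s consecutive leaves).
heightFromRight : ℕ → List ℕ → ℕ
heightFromRight q []       = 0
heightFromRight q (s ∷ ms) with q <? 2 ^ s
... | yes _ = s
... | no  _ = heightFromRight (q ∸ 2 ^ s) ms

-- σ_{U-MMB}(k, n): proof size of leaf h_{n-k+1}, i.e. the k-th leaf from the
-- right (0-based position k-1 from the right), for 1 ≤ k ≤ n.
σ : ℕ → ℕ → ℕ
σ k n = heightFromRight (k ∸ 1) (ummbRev n)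

average : (ℕ → ℕ) → ℕ → ℚ
average f M = (+ sum (map f (upTo (suc M)))) / suc M

CesaroLimit : (ℕ → ℕ) → ℚ → Set
CesaroLimit f L = ∀ (ε : ℚ) → 0ℚ < ε →
  ∃[ M₀ ] (∀ M → M₀ Data.Nat.≤ M → ∣ average f M - L ∣ < ε)

_/2^_ : ℕ → ℕ → ℚ
p /2^ e = _/_ (+ p) (2 ^ e) {{m^n≢0 2 e}}

{-# OPTIONS --safe #-}

-- The U-MMB with n leaves has one mountain per digit of n written in bijective base 2:
-- if n = Σ_{i<ℓ} (1 + uᵢ) 2ⁱ with uᵢ ∈ {0, 1}, its mountains have, from the right, the
-- heights i + uᵢ. Hence, once 2^D > k, σ(k, n) only depends on the lowest D digits of n,
-- which are periodic in n with period 2^D, so the Cesàro limit is the average of σ(k, ·)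
-- over all digit vectors u ∈ {0, 1}^D. Take D = d + 1 and write k + 1 = 2^d + t with
-- 0 ≤ t < 2^d: the k-th leaf from the right lies in mountain d − 1 (height d − 1 + u_{d−1})
-- if t ≤ Σ_{i<d} uᵢ 2ⁱ, and in mountain d (height d + u_d) otherwise. Counting these heights
-- separately for t < 2^(d−1) and for t ≥ 2^(d−1) gives the two formulas.

module Submission where

open import Data.Bool using (Bool; true; false; if_then_else_)
open import Data.Empty using (⊥-elim)
open import Data.Integer as ℤ using (+_; +[1+_]; -[1+_]; _⊖_)
import Data.Integer.Properties as ℤ
open import Data.List using (List; []; _∷_; _++_; _∷ʳ_; length; map; upTo; take; drop; replicate)
open import Data.List.Properties using (map-++; upTo-∷ʳ; length-replicate; take++drop≡id; length-take; length-++)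
open import Data.Nat
open import Data.Nat.GeneralisedArithmetic using (fold; fold-+)
open import Data.Nat.Induction using (<-rec)
open import Data.Nat.ListAction using (sum)
open import Data.Nat.ListAction.Properties using (sum-++)
open import Data.Nat.Logarithm using (⌊log₂_⌋)
open import Data.Nat.Properties
open import Data.Nat.Tactic.RingSolver using (solve-∀)
open import Data.Product using (_×_; _,_)
open import Data.Rational as ℚ using (mkℚ; toℚᵘ; _-_) renaming (_+_ to _+ℚ_)
import Data.Rational.Properties as ℚ
open import Data.Rational.Unnormalised as ℚᵘ using (mkℚᵘ; *≡*; *<*) renaming (_/_ to _/ᵘ_)
import Data.Rational.Unnormalised.Properties as ℚᵘ
open import Data.Sum using (inj₁; inj₂)
open import Function using (_∘_; _$_)
open import Relation.Binary.PropositionalEquality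
open import Relation.Nullary using (yes; no; contradiction)

open import Defs

∑ : (ℕ → ℕ) → ℕ → ℕ
∑ f zero    = 0
∑ f (suc n) = ∑ f n + f n

∑-upTo : ∀ f n → sum (map f (upTo n)) ≡ ∑ f n
∑-upTo f zero    = refl
∑-upTo f (suc n) = begin
  sum (map f (upTo (suc n)))        ≡⟨ cong (sum ∘ map f) (upTo-∷ʳ n) ⟨
  sum (map f (upTo n ++ n ∷ []))    ≡⟨ cong sum (map-++ f (upTo n) (n ∷ [])) ⟩
  sum (map f (upTo n) ++ f n ∷ [])  ≡⟨ sum-++ (map f (upTo n)) (f n ∷ []) ⟩
  sum (map f (upTo n)) + (f n + 0)  ≡⟨ cong₂ _+_ (∑-upTo f n) (+-identityʳ (f n)) ⟩
  ∑ f n + f n                       ∎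
  where open ≡-Reasoning

∑-cong : ∀ {f g} n → (∀ i → i < n → f i ≡ g i) → ∑ f n ≡ ∑ g n
∑-cong zero    f≗g = refl
∑-cong (suc n) f≗g = cong₂ _+_ (∑-cong n (λ i i<n → f≗g i (m<n⇒m<1+n i<n))) (f≗g n ≤-refl)

∑-const : ∀ c n → ∑ (λ _ → c) n ≡ n * c
∑-const c zero    = refl
∑-const c (suc n) = trans (cong (_+ c) (∑-const c n)) (+-comm (n * c) c)

∑-distrib-+ : ∀ f g n → ∑ (λ i → f i + g i) n ≡ ∑ f n + ∑ g n
∑-distrib-+ f g zero    = refl
∑-distrib-+ f g (suc n) =
  trans (cong (_+ (f n + g n)) (∑-distrib-+ f g n)) (+-exchange (∑ f n) (∑ g n) (f n) (g n))
  where
  +-exchange : ∀ a b c d → a + b + (c + d) ≡ a + c + (b + d)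
  +-exchange = solve-∀

∑-split : ∀ f m n → ∑ f (m + n) ≡ ∑ f m + ∑ (λ i → f (m + i)) n
∑-split f m zero    = trans (cong (∑ f) (+-identityʳ m)) (sym (+-identityʳ (∑ f m)))
∑-split f m (suc n) = begin
  ∑ f (m + suc n)                                  ≡⟨ cong (∑ f) (+-suc m n) ⟩
  ∑ f (m + n) + f (m + n)                          ≡⟨ cong (_+ f (m + n)) (∑-split f m n) ⟩
  ∑ f m + ∑ (λ i → f (m + i)) n + f (m + n)        ≡⟨ +-assoc (∑ f m) _ _ ⟩
  ∑ f m + ∑ (λ i → f (m + i)) (suc n)              ∎
  where open ≡-Reasoning

∑-double : ∀ f n → ∑ f (n + n) ≡ ∑ (λ i → f (i + i) + f (suc (i + i))) n
∑-double f zero    = refl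
∑-double f (suc n) = begin
  ∑ f (suc n + suc n)                         ≡⟨ cong (∑ f ∘ suc) (+-suc n n) ⟩
  ∑ f (n + n) + f (n + n) + f (suc (n + n))   ≡⟨ cong (λ s → s + f (n + n) + f (suc (n + n))) (∑-double f n) ⟩
  ∑ g n + f (n + n) + f (suc (n + n))         ≡⟨ +-assoc (∑ g n) (f (n + n)) _ ⟩
  ∑ g (suc n)                                 ∎
  where
  open ≡-Reasoning
  g : ℕ → ℕ
  g i = f (i + i) + f (suc (i + i))

term≤∑ : ∀ f {m n} → m < n → f m ≤ ∑ f n
term≤∑ f {m} {suc n} m<1+n with m≤n⇒m<n∨m≡n (s≤s⁻¹ m<1+n)
... | inj₁ m<n  = ≤-trans (term≤∑ f m<n) (m≤m+n (∑ f n) (f n))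
... | inj₂ refl = m≤n+m (f m) (∑ f m)

∣⊖∣≡∣-∣ : ∀ m n → ℤ.∣ m ⊖ n ∣ ≡ ∣ m - n ∣
∣⊖∣≡∣-∣ m n with ≤-total m n
... | inj₁ m≤n = trans (ℤ.∣⊖∣-≤ m≤n) (sym (m≤n⇒∣m-n∣≡n∸m m≤n))
... | inj₂ n≤m =
  trans (ℤ.∣m⊖n∣≡∣n⊖m∣ m n) (trans (ℤ.∣⊖∣-≤ n≤m) (sym (m≤n⇒∣n-m∣≡n∸m n≤m)))

toℚᵘ-/ : ∀ i n .{{_ : NonZero n}} → toℚᵘ (i ℚ./ n) ℚᵘ.≃ i /ᵘ n
toℚᵘ-/ i (suc n) = ℚ.toℚᵘ-fromℚᵘ (mkℚᵘ i n)

/ᵘ-≃ : ∀ a b m n .{{_ : NonZero m}} .{{_ : NonZero n}} →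
  a * n ≡ b * m → (+ a) /ᵘ m ℚᵘ.≃ (+ b) /ᵘ n
/ᵘ-≃ a b (suc m) (suc n) eq =
  *≡* (trans (sym (ℤ.pos-* a (suc n))) (trans (cong +_ eq) (ℤ.pos-* b (suc m))))

/ᵘ-< : ∀ a b m n .{{_ : NonZero m}} .{{_ : NonZero n}} →
  a * n < b * m → (+ a) /ᵘ m ℚᵘ.< (+ b) /ᵘ n
/ᵘ-< a b (suc m) (suc n) lt =
  *<* (subst₂ ℤ._<_ (ℤ.pos-* a (suc n)) (ℤ.pos-* b (suc m)) (ℤ.+<+ lt))

/ᵘ-+ : ∀ a b m n .{{_ : NonZero m}} .{{_ : NonZero n}} →
  (+ a) /ᵘ m ℚᵘ.+ (+ b) /ᵘ n ℚᵘ.≃ ((+ (a * n + b * m)) /ᵘ (m * n)) {{m*n≢0 m n}}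
/ᵘ-+ a b (suc m) (suc n) = ℚᵘ.≃-reflexive (ℚᵘ./-cong numerator refl)
  where
  numerator : (+ a) ℤ.* (+ suc n) ℤ.+ (+ b) ℤ.* (+ suc m) ≡ + (a * suc n + b * suc m)
  numerator = sym (trans (ℤ.pos-+ (a * suc n) (b * suc m))
                         (cong₂ ℤ._+_ (ℤ.pos-* a (suc n)) (ℤ.pos-* b (suc m))))

∣/ᵘ-/ᵘ∣ : ∀ a b m n .{{_ : NonZero m}} .{{_ : NonZero n}} →
  ℚᵘ.∣ (+ a) /ᵘ m ℚᵘ.- (+ b) /ᵘ n ∣ ℚᵘ.≃ ((+ ∣ a * n - b * m ∣) /ᵘ (m * n)) {{m*n≢0 m n}}
∣/ᵘ-/ᵘ∣ a b (suc m) (suc n) = ℚᵘ.≃-reflexive (cong (λ i → (+ i) /ᵘ (suc m * suc n))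
  (trans (cong ℤ.∣_∣ numerator) (∣⊖∣≡∣-∣ (a * suc n) (b * suc m))))
  where
  numerator : (+ a) ℤ.* (+ suc n) ℤ.+ (ℤ.- (+ b)) ℤ.* (+ suc m) ≡ (a * suc n) ⊖ (b * suc m)
  numerator = begin
    (+ a) ℤ.* (+ suc n) ℤ.+ (ℤ.- (+ b)) ℤ.* (+ suc m)
      ≡⟨ cong₂ ℤ._+_ (ℤ.pos-* a (suc n)) (ℤ.neg-distribˡ-* (+ b) (+ suc m)) ⟨
    + (a * suc n) ℤ.+ ℤ.- ((+ b) ℤ.* (+ suc m))
      ≡⟨ cong (λ i → + (a * suc n) ℤ.- i) (ℤ.pos-* b (suc m)) ⟨
    + (a * suc n) ℤ.- + (b * suc m)
      ≡⟨ ℤ.m-n≡m⊖n (a * suc n) (b * suc m) ⟩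
    (a * suc n) ⊖ (b * suc m)
      ∎
    where open ≡-Reasoning

toℚᵘ-homo-- : ∀ p q → toℚᵘ (p - q) ℚᵘ.≃ toℚᵘ p ℚᵘ.- toℚᵘ q
toℚᵘ-homo-- p q =
  ℚᵘ.≃-trans (ℚ.toℚᵘ-homo-+ p (ℚ.- q)) (ℚᵘ.+-congʳ (toℚᵘ p) (ℚ.toℚᵘ-homo‿- q))

p≃q+r⇒p-r≃q : ∀ {p q r} → p ℚᵘ.≃ q ℚᵘ.+ r → p ℚᵘ.- r ℚᵘ.≃ q
p≃q+r⇒p-r≃q {p} {q} {r} p≃q+r = begin-equality
  p ℚᵘ.- r                ≃⟨ ℚᵘ.+-congˡ (ℚᵘ.- r) p≃q+r ⟩
  q ℚᵘ.+ r ℚᵘ.- r         ≃⟨ ℚᵘ.+-assoc q r (ℚᵘ.- r) ⟩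
  q ℚᵘ.+ (r ℚᵘ.- r)       ≃⟨ ℚᵘ.+-congʳ q (ℚᵘ.+-inverseʳ r) ⟩
  q ℚᵘ.+ ℚᵘ.0ℚᵘ           ≃⟨ ℚᵘ.+-identityʳ q ⟩
  q                       ∎
  where open ℚᵘ.≤-Reasoning

/2^-affine : ∀ a b c S i j → a * 2 ^ (i + j) + b ≡ S + c * 2 ^ j →
  ((a /2^ 0) +ℚ (b /2^ (i + j))) - (c /2^ i) ≡ S /2^ (i + j)
/2^-affine a b c S i j eq = ℚ.toℚᵘ-injective toℚᵘ-affine
  where
  N M R : ℕ
  N = 2 ^ (i + j)
  M = 2 ^ i
  R = 2 ^ j
  instance
    N≢0 : NonZero N
    N≢0 = m^n≢0 2 (i + j)
    M≢0 : NonZero M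
    M≢0 = m^n≢0 2 i
  cross : (a * N + b * 1) * (N * M) ≡ (S * M + c * N) * (1 * N)
  cross = begin
    (a * N + b * 1) * (N * M)   ≡⟨ cong (λ x → (a * N + x) * (N * M)) (*-identityʳ b) ⟩
    (a * N + b) * (N * M)       ≡⟨ cong (_* (N * M)) eq ⟩
    (S + c * R) * (N * M)       ≡⟨ cong (λ n → (S + c * R) * (n * M)) N≡M*R ⟩
    (S + c * R) * (M * R * M)   ≡⟨ regroup S c M R ⟩
    (S * M + c * (M * R)) * (1 * (M * R))
                                ≡⟨ cong (λ n → (S * M + c * n) * (1 * n)) N≡M*R ⟨
    (S * M + c * N) * (1 * N)   ∎
    where
    open ≡-Reasoning
    N≡M*R : N ≡ M * R
    N≡M*R = ^-distribˡ-+-* 2 i j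
    regroup : ∀ S c M R → (S + c * R) * (M * R * M) ≡ (S * M + c * (M * R)) * (1 * (M * R))
    regroup = solve-∀
  sum≃ : (+ a) /ᵘ 1 ℚᵘ.+ (+ b) /ᵘ N ℚᵘ.≃ (+ S) /ᵘ N ℚᵘ.+ (+ c) /ᵘ M
  sum≃ = begin-equality
    (+ a) /ᵘ 1 ℚᵘ.+ (+ b) /ᵘ N                      ≃⟨ /ᵘ-+ a b 1 N ⟩
    ((+ (a * N + b * 1)) /ᵘ (1 * N)) {{m*n≢0 1 N}}   ≃⟨ /ᵘ-≃ _ _ (1 * N) (N * M) {{m*n≢0 1 N}} {{m*n≢0 N M}} cross ⟩
    ((+ (S * M + c * N)) /ᵘ (N * M)) {{m*n≢0 N M}}   ≃⟨ /ᵘ-+ S c N M ⟨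
    (+ S) /ᵘ N ℚᵘ.+ (+ c) /ᵘ M                      ∎
    where open ℚᵘ.≤-Reasoning
  toℚᵘ-affine : toℚᵘ (((a /2^ 0) +ℚ (b /2^ (i + j))) - (c /2^ i)) ℚᵘ.≃ toℚᵘ (S /2^ (i + j))
  toℚᵘ-affine = begin-equality
    toℚᵘ (((a /2^ 0) +ℚ (b /2^ (i + j))) - (c /2^ i))
      ≃⟨ toℚᵘ-homo-- ((a /2^ 0) +ℚ (b /2^ (i + j))) (c /2^ i) ⟩
    toℚᵘ ((a /2^ 0) +ℚ (b /2^ (i + j))) ℚᵘ.- toℚᵘ (c /2^ i)
      ≃⟨ ℚᵘ.+-cong (ℚᵘ.≃-trans (ℚ.toℚᵘ-homo-+ (a /2^ 0) (b /2^ (i + j)))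
                               (ℚᵘ.+-cong (toℚᵘ-/ (+ a) 1) (toℚᵘ-/ (+ b) N)))
                   (ℚᵘ.-‿cong (toℚᵘ-/ (+ c) M)) ⟩
    (+ a) /ᵘ 1 ℚᵘ.+ (+ b) /ᵘ N ℚᵘ.- (+ c) /ᵘ M
      ≃⟨ p≃q+r⇒p-r≃q sum≃ ⟩
    (+ S) /ᵘ N
      ≃⟨ toℚᵘ-/ (+ S) N ⟨
    toℚᵘ (S /2^ (i + j))
      ∎
    where open ℚᵘ.≤-Reasoning

-- Cesàro limits of eventually periodic sequences

eventually-periodic⇒bounded : ∀ (g : ℕ → ℕ) P i₀ .{{_ : NonZero P}} →
  (∀ i → i₀ ≤ i → g (i + P) ≡ g i) → ∀ n → g n ≤ ∑ g (i₀ + P)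
eventually-periodic⇒bounded g P i₀ periodic = <-rec _ bound
  where
  bound : ∀ n → (∀ {m} → m < n → g m ≤ ∑ g (i₀ + P)) → g n ≤ ∑ g (i₀ + P)
  bound n rec with n <? i₀ + P
  ... | yes n<i₀+P = term≤∑ g n<i₀+P
  ... | no  n≮i₀+P = begin
    g n             ≡⟨ cong g (m∸n+n≡m P≤n) ⟨
    g (n ∸ P + P)   ≡⟨ periodic (n ∸ P) i₀≤n∸P ⟩
    g (n ∸ P)       ≤⟨ rec (∸-monoʳ-< (>-nonZero⁻¹ P) P≤n) ⟩
    ∑ g (i₀ + P)    ∎
    where
    open ≤-Reasoning
    i₀+P≤n : i₀ + P ≤ n
    i₀+P≤n = ≮⇒≥ n≮i₀+P
    P≤n : P ≤ n
    P≤n = ≤-trans (m≤n+m P i₀) i₀+P≤n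
    i₀≤n∸P : i₀ ≤ n ∸ P
    i₀≤n∸P = subst (_≤ n ∸ P) (m+n∸n≡m i₀ P) (∸-monoˡ-≤ P i₀+P≤n)

-- With N = M + 1, ∣average f M − S / P∣ = ∣∑ f N · P − S · N∣ / (N · P) ≤ K / N.
bounded-deviation⇒CesaroLimit : ∀ f P S K .{{_ : NonZero P}} →
  (∀ n → ∣ ∑ f n * P - S * n ∣ ≤ K) → CesaroLimit f ((+ S) ℚ./ P)
bounded-deviation⇒CesaroLimit f P S K bounded ε@(mkℚ +[1+ a ] b _) _ = K * suc b , close
  where
  close : ∀ M → K * suc b ≤ M → ℚ.∣ average f M - (+ S) ℚ./ P ∣ ℚ.< ε
  close M K*b≤M =
    ℚ.toℚᵘ-cancel-< (ℚᵘ.<-respˡ-≃ (ℚᵘ.≃-sym distance) (/ᵘ-< _ _ _ _ {{m*n≢0 N P}} deviation<ε))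
    where
    N = suc M
    F = ∑ f N
    distance : toℚᵘ ℚ.∣ average f M - (+ S) ℚ./ P ∣ ℚᵘ.≃ ((+ ∣ F * P - S * N ∣) /ᵘ (N * P)) {{m*n≢0 N P}}
    distance = begin-equality
      toℚᵘ ℚ.∣ average f M - (+ S) ℚ./ P ∣
        ≃⟨ ℚ.toℚᵘ-homo-∣-∣ (average f M - (+ S) ℚ./ P) ⟩
      ℚᵘ.∣ toℚᵘ (average f M - (+ S) ℚ./ P) ∣
        ≃⟨ ℚᵘ.∣-∣-cong (toℚᵘ-homo-- (average f M) ((+ S) ℚ./ P)) ⟩
      ℚᵘ.∣ toℚᵘ (average f M) ℚᵘ.- toℚᵘ ((+ S) ℚ./ P) ∣
        ≃⟨ ℚᵘ.∣-∣-cong (ℚᵘ.+-cong average≃ (ℚᵘ.-‿cong (toℚᵘ-/ (+ S) P))) ⟩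
      ℚᵘ.∣ (+ F) /ᵘ N ℚᵘ.- (+ S) /ᵘ P ∣
        ≃⟨ ∣/ᵘ-/ᵘ∣ F S N P ⟩
      ((+ ∣ F * P - S * N ∣) /ᵘ (N * P)) {{m*n≢0 N P}}
        ∎
      where
      open ℚᵘ.≤-Reasoning
      average≃ : toℚᵘ (average f M) ℚᵘ.≃ (+ F) /ᵘ N
      average≃ = subst (λ F′ → toℚᵘ (average f M) ℚᵘ.≃ (+ F′) /ᵘ N) (∑-upTo f N) (toℚᵘ-/ _ N)
    deviation<ε : ∣ F * P - S * N ∣ * suc b < suc a * (N * P)
    deviation<ε = begin-strict
      ∣ F * P - S * N ∣ * suc b  ≤⟨ *-monoˡ-≤ (suc b) (bounded N) ⟩
      K * suc b                  ≤⟨ K*b≤M ⟩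
      M                          <⟨ n<1+n M ⟩
      N                          ≤⟨ m≤m*n N P ⟩
      N * P                      ≤⟨ m≤n*m (N * P) (suc a) ⟩
      suc a * (N * P)            ∎
      where open ≤-Reasoning
bounded-deviation⇒CesaroLimit f P S K bounded (mkℚ (+ zero) _ _) 0<ε =
  ⊥-elim (ℤ.Positive.pos (ℚ.positive 0<ε))
bounded-deviation⇒CesaroLimit f P S K bounded (mkℚ -[1+ _ ] _ _) 0<ε =
  ⊥-elim (ℤ.Positive.pos (ℚ.positive 0<ε))

module _ (f : ℕ → ℕ) (P i₀ : ℕ) (periodic : ∀ i → i₀ ≤ i → f (i + P) ≡ f i) where

  private
    S : ℕ
    S = ∑ (λ j → f (i₀ + j)) P

  ∑-+-period : ∀ n → i₀ ≤ n → ∑ f (n + P) ≡ ∑ f n + S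
  ∑-+-period n i₀≤n = go (≤⇒≤′ i₀≤n)
    where
    go : ∀ {n} → i₀ ≤′ n → ∑ f (n + P) ≡ ∑ f n + S
    go ≤′-refl = ∑-split f i₀ P
    go {suc n} (≤′-step i₀≤′n) = begin
      ∑ f (n + P) + f (n + P)  ≡⟨ cong₂ _+_ (go i₀≤′n) (periodic n (≤′⇒≤ i₀≤′n)) ⟩
      ∑ f n + S + f n          ≡⟨ +-assoc (∑ f n) S (f n) ⟩
      ∑ f n + (S + f n)        ≡⟨ cong (_+_ (∑ f n)) (+-comm S (f n)) ⟩
      ∑ f n + (f n + S)        ≡⟨ +-assoc (∑ f n) (f n) S ⟨
      ∑ f (suc n) + S          ∎
      where open ≡-Reasoning

  deviation-+-period : ∀ n → i₀ ≤ n → ∣ ∑ f (n + P) * P - S * (n + P) ∣ ≡ ∣ ∑ f n * P - S * n ∣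
  deviation-+-period n i₀≤n = begin
    ∣ ∑ f (n + P) * P - S * (n + P) ∣
      ≡⟨ cong (λ s → ∣ s * P - S * (n + P) ∣) (∑-+-period n i₀≤n) ⟩
    ∣ (∑ f n + S) * P - S * (n + P) ∣
      ≡⟨ cong₂ ∣_-_∣ (rearrangeˡ (∑ f n) S P) (rearrangeʳ S n P) ⟩
    ∣ S * P + ∑ f n * P - S * P + S * n ∣
      ≡⟨ ∣m+n-m+o∣≡∣n-o∣ (S * P) (∑ f n * P) (S * n) ⟩
    ∣ ∑ f n * P - S * n ∣
      ∎
    where
    open ≡-Reasoning
    rearrangeˡ : ∀ x s p → (x + s) * p ≡ s * p + x * p
    rearrangeˡ = solve-∀
    rearrangeʳ : ∀ s n p → s * (n + p) ≡ s * p + s * n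
    rearrangeʳ = solve-∀

  eventually-periodic⇒CesaroLimit : .{{_ : NonZero P}} → CesaroLimit f ((+ S) ℚ./ P)
  eventually-periodic⇒CesaroLimit = bounded-deviation⇒CesaroLimit f P S _
    (eventually-periodic⇒bounded (λ n → ∣ ∑ f n * P - S * n ∣) P i₀ deviation-+-period)

-- The U-MMB in bijective base 2

-- Bijective base-2 numerals, least significant digit first: false and true stand for the
-- digits 1 and 2, so that n = Σᵢ (1 + bit bᵢ) 2ⁱ.
increment : List Bool → List Bool
increment []           = false ∷ []
increment (false ∷ bs) = true ∷ bs
increment (true  ∷ bs) = false ∷ increment bs

digits : ℕ → List Bool
digits = fold [] increment

bit : Bool → ℕ
bit false = 0
bit true  = 1

mountains : ℕ → List Bool → List ℕ
mountains j []       = []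
mountains j (b ∷ bs) = bit b + j ∷ mountains (suc j) bs

mergeFrom-mountains : ∀ j bs → mergeFrom j (mountains j bs) ≡ mountains j (increment bs)
mergeFrom-mountains j []           = refl
mergeFrom-mountains j (false ∷ bs) with j ≟ j
... | yes _   = refl
... | no  j≢j = contradiction refl j≢j
mergeFrom-mountains j (true ∷ bs) with j ≟ suc j
... | yes j≡1+j = contradiction (sym j≡1+j) 1+n≢n
... | no  _     = cong (j ∷_) (mergeFrom-mountains (suc j) bs)

ummbRev≡mountains : ∀ n → ummbRev n ≡ mountains 0 (digits n)
ummbRev≡mountains zero    = refl
ummbRev≡mountains (suc n) =
  trans (cong (mergeFrom 0) (ummbRev≡mountains n)) (mergeFrom-mountains 0 (digits n))

mountains-++ : ∀ j xs ys → mountains j (xs ++ ys) ≡ mountains j xs ++ mountains (length xs + j) ys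
mountains-++ j []       ys = refl
mountains-++ j (x ∷ xs) ys = cong (bit x + j ∷_) (trans (mountains-++ (suc j) xs ys)
  (cong (λ i → mountains (suc j) xs ++ mountains i ys) (+-suc (length xs) j)))

mountains-∷ʳ : ∀ u x → mountains 0 (u ∷ʳ x) ≡ mountains 0 u ++ (bit x + length u) ∷ []
mountains-∷ʳ u x = trans (mountains-++ 0 u (x ∷ []))
  (cong (λ i → mountains 0 u ++ (bit x + i) ∷ []) (+-identityʳ (length u)))

leafCount : List ℕ → ℕ
leafCount []       = 0
leafCount (s ∷ ms) = 2 ^ s + leafCount ms

leafCount-∷ʳ : ∀ ms s → leafCount (ms ∷ʳ s) ≡ leafCount ms + 2 ^ s
leafCount-∷ʳ []       s = +-identityʳ (2 ^ s)
leafCount-∷ʳ (m ∷ ms) s = trans (cong (_+_ (2 ^ m)) (leafCount-∷ʳ ms s)) (sym (+-assoc (2 ^ m) _ _))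

heightFromRight-++ˡ : ∀ {q} xs ys → q < leafCount xs →
  heightFromRight q (xs ++ ys) ≡ heightFromRight q xs
heightFromRight-++ˡ {q} (s ∷ xs) ys q<2^s+xs with q <? 2 ^ s
... | yes _     = refl
... | no  q≮2^s = heightFromRight-++ˡ xs ys (+-cancelˡ-< (2 ^ s) _ _
                    (subst (_< 2 ^ s + leafCount xs) (sym (m+[n∸m]≡n (≮⇒≥ q≮2^s))) q<2^s+xs))

heightFromRight-++ʳ : ∀ xs ys r → heightFromRight (leafCount xs + r) (xs ++ ys) ≡ heightFromRight r ys
heightFromRight-++ʳ []       ys r = refl
heightFromRight-++ʳ (s ∷ xs) ys r with 2 ^ s + leafCount xs + r <? 2 ^ s
... | yes q<2^s = contradiction q<2^s (≤⇒≯ (≤-trans (m≤m+n (2 ^ s) (leafCount xs)) (m≤m+n _ r)))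
... | no  _     = trans (cong (λ q → heightFromRight q (xs ++ ys)) skip) (heightFromRight-++ʳ xs ys r)
  where
  skip : 2 ^ s + leafCount xs + r ∸ 2 ^ s ≡ leafCount xs + r
  skip = trans (cong (_∸ 2 ^ s) (+-assoc (2 ^ s) (leafCount xs) r)) (m+n∸m≡n (2 ^ s) _)

heightFromRight-∷ʳ : ∀ ms s {q} → leafCount ms ≤ q → q < leafCount ms + 2 ^ s →
  heightFromRight q (ms ∷ʳ s) ≡ s
heightFromRight-∷ʳ ms s {q} ms≤q q<ms+2^s = begin
  heightFromRight q (ms ∷ʳ s)                   ≡⟨ cong (λ q → heightFromRight q (ms ∷ʳ s)) ms+r≡q ⟨
  heightFromRight (leafCount ms + r) (ms ∷ʳ s)  ≡⟨ heightFromRight-++ʳ ms (s ∷ []) r ⟩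
  heightFromRight r (s ∷ [])                    ≡⟨ heightFromRight-singleton ⟩
  s                                             ∎
  where
  open ≡-Reasoning
  r = q ∸ leafCount ms
  ms+r≡q : leafCount ms + r ≡ q
  ms+r≡q = m+[n∸m]≡n ms≤q
  heightFromRight-singleton : heightFromRight r (s ∷ []) ≡ s
  heightFromRight-singleton with r <? 2 ^ s
  ... | yes _     = refl
  ... | no  r≮2^s = contradiction
    (+-cancelˡ-< (leafCount ms) r (2 ^ s) (subst (_< leafCount ms + 2 ^ s) (sym ms+r≡q) q<ms+2^s)) r≮2^s

val : List Bool → ℕ
val []       = 0
val (b ∷ bs) = bit b + (val bs + val bs)

bit≤1 : ∀ b → bit b ≤ 1
bit≤1 false = z≤n
bit≤1 true  = s≤s z≤n

val<2^length : ∀ u → val u < 2 ^ length u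
val<2^length []      = s≤s z≤n
val<2^length (b ∷ u) = begin-strict
  bit b + (val u + val u)            ≤⟨ +-monoˡ-≤ (val u + val u) (bit≤1 b) ⟩
  1 + (val u + val u)                <⟨ +-mono-≤-< (val<2^length u) (val<2^length u) ⟩
  2 ^ length u + 2 ^ length u        ≡⟨ cong (_+_ (2 ^ length u)) (+-identityʳ (2 ^ length u)) ⟨
  2 ^ length u + (2 ^ length u + 0) ∎
  where open ≤-Reasoning

val-∷ʳ : ∀ w c → val (w ∷ʳ c) ≡ bit c * 2 ^ length w + val w
val-∷ʳ []      c = trans (+-identityʳ (bit c)) (sym (trans (+-identityʳ _) (*-identityʳ (bit c))))
val-∷ʳ (b ∷ w) c =
  trans (cong (λ v → bit b + (v + v)) (val-∷ʳ w c)) (rearrange (bit b) (bit c) (2 ^ length w) (val w))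
  where
  rearrange : ∀ β γ X v → β + ((γ * X + v) + (γ * X + v)) ≡ γ * (X + (X + 0)) + (β + (v + v))
  rearrange = solve-∀

2^[bit+j] : ∀ b j → 2 ^ (bit b + j) ≡ (1 + bit b) * 2 ^ j
2^[bit+j] false j = sym (*-identityˡ (2 ^ j))
2^[bit+j] true  j = refl

leafCount-mountains : ∀ j u → leafCount (mountains j u) + 2 ^ j ≡ 2 ^ j * (2 ^ length u + val u)
leafCount-mountains j []      = sym (trans (*-comm (2 ^ j) 1) (*-identityˡ (2 ^ j)))
leafCount-mountains j (b ∷ u) = begin
  2 ^ (bit b + j) + L + X                  ≡⟨ cong (λ p → p + L + X) (2^[bit+j] b j) ⟩
  (1 + bit b) * X + L + X                  ≡⟨ rearrange₁ (bit b) X L ⟩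
  (L + 2 * X) + bit b * X                  ≡⟨ cong (_+ bit b * X) (leafCount-mountains (suc j) u) ⟩
  2 * X * (Y + val u) + bit b * X          ≡⟨ rearrange₂ (bit b) X Y (val u) ⟩
  X * (2 * Y + (bit b + (val u + val u)))  ∎
  where
  open ≡-Reasoning
  X = 2 ^ j
  Y = 2 ^ length u
  L = leafCount (mountains (suc j) u)
  rearrange₁ : ∀ β X L → (1 + β) * X + L + X ≡ (L + 2 * X) + β * X
  rearrange₁ = solve-∀
  rearrange₂ : ∀ β X Y v → 2 * X * (Y + v) + β * X ≡ X * (2 * Y + (β + (v + v)))
  rearrange₂ = solve-∀

suc-leafCount-mountains : ∀ u → suc (leafCount (mountains 0 u)) ≡ 2 ^ length u + val u
suc-leafCount-mountains u = trans (+-comm 1 _) (trans (leafCount-mountains 0 u) (*-identityˡ _))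

2^length≤1+leafCount : ∀ u → 2 ^ length u ≤ suc (leafCount (mountains 0 u))
2^length≤1+leafCount u =
  subst (2 ^ length u ≤_) (sym (suc-leafCount-mountains u)) (m≤m+n (2 ^ length u) (val u))

leafHeight : ℕ → List Bool → ℕ
leafHeight q u = heightFromRight q (mountains 0 u)

-- Periodicity of the low digits

increment-twice : ∀ b bs → increment (increment (b ∷ bs)) ≡ b ∷ increment bs
increment-twice false bs = refl
increment-twice true  bs = refl

fold-increment-double : ∀ m b bs → fold (b ∷ bs) increment (m + m) ≡ b ∷ fold bs increment m
fold-increment-double zero    b bs = refl
fold-increment-double (suc m) b bs = begin
  fold (b ∷ bs) increment (suc m + suc m)
    ≡⟨ cong (λ n → fold (b ∷ bs) increment (suc n)) (+-suc m m) ⟩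
  increment (increment (fold (b ∷ bs) increment (m + m)))
    ≡⟨ cong (increment ∘ increment) (fold-increment-double m b bs) ⟩
  increment (increment (b ∷ fold bs increment m))
    ≡⟨ increment-twice b (fold bs increment m) ⟩
  b ∷ fold bs increment (suc m)
    ∎
  where open ≡-Reasoning

take-fold-increment-2^ : ∀ D bs → D ≤ length bs → take D (fold bs increment (2 ^ D)) ≡ take D bs
take-fold-increment-2^ zero    bs       _          = refl
take-fold-increment-2^ (suc D) (b ∷ bs) (s≤s D≤bs) = begin
  take (suc D) (fold (b ∷ bs) increment (2 ^ D + (2 ^ D + 0)))
    ≡⟨ cong (λ n → take (suc D) (fold (b ∷ bs) increment (2 ^ D + n))) (+-identityʳ (2 ^ D)) ⟩
  take (suc D) (fold (b ∷ bs) increment (2 ^ D + 2 ^ D))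
    ≡⟨ cong (take (suc D)) (fold-increment-double (2 ^ D) b bs) ⟩
  b ∷ take D (fold bs increment (2 ^ D))
    ≡⟨ cong (b ∷_) (take-fold-increment-2^ D bs D≤bs) ⟩
  b ∷ take D bs
    ∎
  where open ≡-Reasoning

length-increment : ∀ bs → length bs ≤ length (increment bs)
length-increment []           = z≤n
length-increment (false ∷ bs) = ≤-refl
length-increment (true  ∷ bs) = s≤s (length-increment bs)

length-fold-increment : ∀ m bs → length bs ≤ length (fold bs increment m)
length-fold-increment zero    bs = ≤-refl
length-fold-increment (suc m) bs =
  ≤-trans (length-fold-increment m bs) (length-increment (fold bs increment m))

repunit : ℕ → ℕ
repunit zero    = 0
repunit (suc j) = suc (repunit j + repunit j)

suc-repunit : ∀ j → suc (repunit j) ≡ 2 ^ j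
suc-repunit zero    = refl
suc-repunit (suc j) = begin
  suc (suc (repunit j + repunit j))  ≡⟨ cong suc (+-suc (repunit j) (repunit j)) ⟨
  suc (repunit j) + suc (repunit j)  ≡⟨ cong₂ _+_ (suc-repunit j) (trans (suc-repunit j) (sym (+-identityʳ (2 ^ j)))) ⟩
  2 ^ j + (2 ^ j + 0)                ∎
  where open ≡-Reasoning

digits-odd : ∀ m → digits (suc (m + m)) ≡ false ∷ digits m
digits-odd m = begin
  digits (suc (m + m))                ≡⟨ cong digits (+-comm 1 (m + m)) ⟩
  digits (m + m + 1)                  ≡⟨ fold-+ [] increment (m + m) ⟩
  fold (false ∷ []) increment (m + m) ≡⟨ fold-increment-double m false [] ⟩
  false ∷ digits m                    ∎
  where open ≡-Reasoning

digits-repunit : ∀ j → digits (repunit j) ≡ replicate j false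
digits-repunit zero    = refl
digits-repunit (suc j) = trans (digits-odd (repunit j)) (cong (false ∷_) (digits-repunit j))

length-digits : ∀ D n → repunit D ≤ n → D ≤ length (digits n)
length-digits D n rD≤n = begin
  D                                            ≡⟨ length-replicate D ⟨
  length (replicate D false)                   ≡⟨ cong length (digits-repunit D) ⟨
  length (digits (repunit D))                  ≤⟨ length-fold-increment m (digits (repunit D)) ⟩
  length (fold (digits (repunit D)) increment m) ≡⟨ cong length (fold-+ [] increment m) ⟨
  length (digits (m + repunit D))              ≡⟨ cong (length ∘ digits) (m∸n+n≡m rD≤n) ⟩
  length (digits n)                            ∎
  where
  open ≤-Reasoning
  m = n ∸ repunit D

σ≡leafHeight-take : ∀ q D n → suc q < 2 ^ D → D ≤ length (digits n) →
  σ (suc q) n ≡ leafHeight q (take D (digits n))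
σ≡leafHeight-take q D n 1+q<2^D D≤n = begin
  heightFromRight q (ummbRev n)
    ≡⟨ cong (heightFromRight q) (ummbRev≡mountains n) ⟩
  heightFromRight q (mountains 0 (digits n))
    ≡⟨ cong (heightFromRight q ∘ mountains 0) (take++drop≡id D (digits n)) ⟨
  heightFromRight q (mountains 0 (low ++ drop D (digits n)))
    ≡⟨ cong (heightFromRight q) (mountains-++ 0 low (drop D (digits n))) ⟩
  heightFromRight q (mountains 0 low ++ mountains (length low + 0) (drop D (digits n)))
    ≡⟨ heightFromRight-++ˡ (mountains 0 low) _ q<low ⟩
  leafHeight q low
    ∎
  where
  open ≡-Reasoning
  low = take D (digits n)
  length-low : length low ≡ D
  length-low = trans (length-take D (digits n)) (m≤n⇒m⊓n≡m D≤n)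
  q<low : q < leafCount (mountains 0 low)
  q<low = s≤s⁻¹ (<-≤-trans 1+q<2^D
    (subst (λ l → 2 ^ l ≤ suc (leafCount (mountains 0 low))) length-low (2^length≤1+leafCount low)))

σ-2^+ : ∀ q D n → suc q < 2 ^ D → repunit D ≤ n → σ (suc q) (2 ^ D + n) ≡ σ (suc q) n
σ-2^+ q D n 1+q<2^D rD≤n = begin
  σ (suc q) (2 ^ D + n)
    ≡⟨ σ≡leafHeight-take q D (2 ^ D + n) 1+q<2^D (length-digits D _ (≤-trans rD≤n (m≤n+m n (2 ^ D)))) ⟩
  leafHeight q (take D (digits (2 ^ D + n)))
    ≡⟨ cong (leafHeight q ∘ take D) (fold-+ [] increment (2 ^ D)) ⟩
  leafHeight q (take D (fold (digits n) increment (2 ^ D)))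
    ≡⟨ cong (leafHeight q) (take-fold-increment-2^ D (digits n) D≤n) ⟩
  leafHeight q (take D (digits n))
    ≡⟨ σ≡leafHeight-take q D n 1+q<2^D D≤n ⟨
  σ (suc q) n
    ∎
  where
  open ≡-Reasoning
  D≤n = length-digits D n rD≤n

-- Summing over one period

∑Vectors : ℕ → (List Bool → ℕ) → ℕ
∑Vectors zero    g = g []
∑Vectors (suc j) g = ∑Vectors j (λ u → g (false ∷ u)) + ∑Vectors j (λ u → g (true ∷ u))

∑-take-fold-increment : ∀ j g →
  ∑ (λ i → g (take j (fold (replicate j false) increment i))) (2 ^ j) ≡ ∑Vectors j g
∑-take-fold-increment zero    g = refl
∑-take-fold-increment (suc j) g = begin
  ∑ h (2 ^ j + (2 ^ j + 0))
    ≡⟨ cong (λ n → ∑ h (2 ^ j + n)) (+-identityʳ (2 ^ j)) ⟩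
  ∑ h (2 ^ j + 2 ^ j)
    ≡⟨ ∑-double h (2 ^ j) ⟩
  ∑ (λ i → h (i + i) + h (suc (i + i))) (2 ^ j)
    ≡⟨ ∑-cong (2 ^ j) (λ i _ → cong₂ _+_
         (cong (g ∘ take (suc j)) (fold-increment-double i false R))
         (cong (g ∘ take (suc j) ∘ increment) (fold-increment-double i false R))) ⟩
  ∑ (λ i → g (false ∷ low i) + g (true ∷ low i)) (2 ^ j)
    ≡⟨ ∑-distrib-+ (λ i → g (false ∷ low i)) (λ i → g (true ∷ low i)) (2 ^ j) ⟩
  ∑ (λ i → g (false ∷ low i)) (2 ^ j) + ∑ (λ i → g (true ∷ low i)) (2 ^ j)
    ≡⟨ cong₂ _+_ (∑-take-fold-increment j (g ∘ (false ∷_))) (∑-take-fold-increment j (g ∘ (true ∷_))) ⟩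
  ∑Vectors (suc j) g
    ∎
  where
  open ≡-Reasoning
  R = replicate j false
  h : ℕ → ℕ
  h i = g (take (suc j) (fold (false ∷ R) increment i))
  low : ℕ → List Bool
  low i = take j (fold R increment i)

∑Vectors-cong : ∀ j {g h} → (∀ u → length u ≡ j → g u ≡ h u) → ∑Vectors j g ≡ ∑Vectors j h
∑Vectors-cong zero    g≗h = g≗h [] refl
∑Vectors-cong (suc j) g≗h = cong₂ _+_ (∑Vectors-cong j (λ u len-u → g≗h (false ∷ u) (cong suc len-u)))
                                      (∑Vectors-cong j (λ u len-u → g≗h (true ∷ u) (cong suc len-u)))

∑Vectors-∷ʳ : ∀ j g → ∑Vectors (suc j) g ≡ ∑Vectors j (λ u → g (u ∷ʳ false) + g (u ∷ʳ true))
∑Vectors-∷ʳ zero    g = refl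
∑Vectors-∷ʳ (suc j) g = cong₂ _+_ (∑Vectors-∷ʳ j (g ∘ (false ∷_))) (∑Vectors-∷ʳ j (g ∘ (true ∷_)))

∑Vectors-val : ∀ j φ → ∑Vectors j (φ ∘ val) ≡ ∑ φ (2 ^ j)
∑Vectors-val zero    φ = refl
∑Vectors-val (suc j) φ = begin
  ∑Vectors j (λ u → φ (val u + val u)) + ∑Vectors j (λ u → φ (suc (val u + val u)))
    ≡⟨ cong₂ _+_ (∑Vectors-val j (λ v → φ (v + v))) (∑Vectors-val j (λ v → φ (suc (v + v)))) ⟩
  ∑ (λ v → φ (v + v)) (2 ^ j) + ∑ (λ v → φ (suc (v + v))) (2 ^ j)
    ≡⟨ ∑-distrib-+ (λ v → φ (v + v)) (λ v → φ (suc (v + v))) (2 ^ j) ⟨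
  ∑ (λ v → φ (v + v) + φ (suc (v + v))) (2 ^ j)
    ≡⟨ ∑-double φ (2 ^ j) ⟨
  ∑ φ (2 ^ j + 2 ^ j)
    ≡⟨ cong (λ n → ∑ φ (2 ^ j + n)) (+-identityʳ (2 ^ j)) ⟨
  ∑ φ (2 ^ suc j)
    ∎
  where open ≡-Reasoning

threshold : ℕ → ℕ → ℕ → ℕ → ℕ
threshold t a b y = if t ≤ᵇ y then a else b

threshold-≥ : ∀ {t y} a b → t ≤ y → threshold t a b y ≡ a
threshold-≥ {t} {y} a b t≤y with t ≤ᵇ y | ≤⇒≤ᵇ t≤y
... | true | _ = refl

threshold-< : ∀ {t y} a b → y < t → threshold t a b y ≡ b
threshold-< {t} {y} a b y<t with t ≤ᵇ y | ≤ᵇ⇒≤ t y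
... | true  | t≤y = contradiction (t≤y _) (<⇒≱ y<t)
... | false | _   = refl

threshold-cong : ∀ {t y a a′} b → (t ≤ y → a ≡ a′) → threshold t a b y ≡ threshold t a′ b y
threshold-cong {t} {y} b a≡a′ with t ≤ᵇ y | ≤ᵇ⇒≤ t y
... | true  | t≤y = a≡a′ (t≤y _)
... | false | _   = refl

threshold-+ : ∀ t a b a′ b′ y →
  threshold t a b y + threshold t a′ b′ y ≡ threshold t (a + a′) (b + b′) y
threshold-+ t a b a′ b′ y with t ≤ᵇ y
... | true  = refl
... | false = refl

threshold-shift : ∀ m t a b y → threshold (m + t) a b (m + y) ≡ threshold t a b y
threshold-shift m t a b y with t ≤? y
... | yes t≤y = trans (threshold-≥ a b (+-monoʳ-≤ m t≤y)) (sym (threshold-≥ a b t≤y))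
... | no  t≰y = trans (threshold-< a b (+-monoʳ-< m (≰⇒> t≰y))) (sym (threshold-< a b (≰⇒> t≰y)))

∑-threshold : ∀ t r a b → ∑ (threshold t a b) (t + r) ≡ t * b + r * a
∑-threshold t r a b = begin
  ∑ (threshold t a b) (t + r)
    ≡⟨ ∑-split (threshold t a b) t r ⟩
  ∑ (threshold t a b) t + ∑ (λ i → threshold t a b (t + i)) r
    ≡⟨ cong₂ _+_ (∑-cong t (λ i i<t → threshold-< a b i<t))
                 (∑-cong r (λ i _ → threshold-≥ a b (m≤m+n t i))) ⟩
  ∑ (λ _ → b) t + ∑ (λ _ → a) r
    ≡⟨ cong₂ _+_ (∑-const b t) (∑-const a r) ⟩
  t * b + r * a
    ∎
  where open ≡-Reasoning

-- The sum of σ over both values of the digit u_d, for digit vectors whose lower digits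
-- u₀ … u_{d−1} have binary value y: if t ≤ y the leaf lies in one of the first d mountains,
-- of height g, and otherwise in mountain d, of height d + u_d.
heightPair : ℕ → ℕ → ℕ → ℕ → ℕ
heightPair d t g = threshold t (g + g) (d + suc d)

-- Here d = e + 1 and v is the value of u₀ … u_{e−1}, so y = v + 2^e u_e; when t ≤ y the
-- leaf lies in mountain e, of height e + u_e.
periodSum : ℕ → ℕ → ℕ
periodSum e t = ∑ (λ v → heightPair (suc e) t e v + heightPair (suc e) t (suc e) (2 ^ e + v)) (2 ^ e)

periodSum-low : ∀ e t r → t + r ≡ 2 ^ e →
  periodSum e t ≡ t * (suc e + suc (suc e)) + r * (e + e) + 2 ^ e * (suc e + suc e)
periodSum-low e t r t+r≡X = begin
  ∑ (λ v → heightPair d t e v + heightPair d t d (X + v)) X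
    ≡⟨ ∑-distrib-+ (heightPair d t e) (λ v → heightPair d t d (X + v)) X ⟩
  ∑ (heightPair d t e) X + ∑ (λ v → heightPair d t d (X + v)) X
    ≡⟨ cong₂ _+_ (trans (cong (∑ (heightPair d t e)) (sym t+r≡X)) (∑-threshold t r (e + e) (d + suc d)))
                 (trans (∑-cong X (λ v _ → threshold-≥ (d + d) (d + suc d) t≤X+v)) (∑-const (d + d) X)) ⟩
  t * (d + suc d) + r * (e + e) + X * (d + d)
    ∎
  where
  open ≡-Reasoning
  d = suc e
  X = 2 ^ e
  t≤X+v : ∀ {v} → t ≤ X + v
  t≤X+v {v} = ≤-trans (subst (t ≤_) t+r≡X (m≤m+n t r)) (m≤m+n X v)

periodSum-high : ∀ e t′ r → t′ + r ≡ 2 ^ e →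
  periodSum e (2 ^ e + t′) ≡ 2 ^ e * (suc e + suc (suc e)) + (t′ * (suc e + suc (suc e)) + r * (suc e + suc e))
periodSum-high e t′ r t′+r≡X = begin
  ∑ (λ v → heightPair d t e v + heightPair d t d (X + v)) X
    ≡⟨ ∑-distrib-+ (heightPair d t e) (λ v → heightPair d t d (X + v)) X ⟩
  ∑ (heightPair d t e) X + ∑ (λ v → heightPair d t d (X + v)) X
    ≡⟨ cong₂ _+_ (trans (∑-cong X (λ v v<X → threshold-< (e + e) (d + suc d) (<-≤-trans v<X (m≤m+n X t′))))
                        (∑-const (d + suc d) X))
                 (trans (∑-cong X (λ v _ → threshold-shift X t′ (d + d) (d + suc d) v))
                        (trans (cong (∑ (heightPair d t′ d)) (sym t′+r≡X)) (∑-threshold t′ r (d + d) (d + suc d)))) ⟩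
  X * (d + suc d) + (t′ * (d + suc d) + r * (d + d))
    ∎
  where
  open ≡-Reasoning
  d = suc e
  X = 2 ^ e
  t = X + t′

-- The leaf at position q from the right, i.e. k = q + 1, where k + 1 = 2^d + t with d = e + 1.
module LeafPosition (q e t : ℕ) (2+q≡2^d+t : 2 + q ≡ 2 ^ suc e + t) (t<2^d : t < 2 ^ suc e) where

  private
    d X : ℕ
    d = suc e
    X = 2 ^ e

    suc-leafCount : ∀ u {j} → length u ≡ j → suc (leafCount (mountains 0 u)) ≡ 2 ^ j + val u
    suc-leafCount u refl = suc-leafCount-mountains u

    t≤val⇒q<leafCount : ∀ u → length u ≡ d → t ≤ val u → q < leafCount (mountains 0 u)
    t≤val⇒q<leafCount u len-u t≤u = s≤s⁻¹ (begin
      2 + q                            ≡⟨ 2+q≡2^d+t ⟩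
      2 ^ d + t                        ≤⟨ +-monoʳ-≤ (2 ^ d) t≤u ⟩
      2 ^ d + val u                    ≡⟨ suc-leafCount u len-u ⟨
      suc (leafCount (mountains 0 u))  ∎)
      where open ≤-Reasoning

    val<t⇒leafCount≤q : ∀ u → length u ≡ d → val u < t → leafCount (mountains 0 u) ≤ q
    val<t⇒leafCount≤q u len-u u<t = s≤s⁻¹ (s≤s⁻¹ (begin-strict
      suc (leafCount (mountains 0 u))  ≡⟨ suc-leafCount u len-u ⟩
      2 ^ d + val u                    <⟨ +-monoʳ-< (2 ^ d) u<t ⟩
      2 ^ d + t                        ≡⟨ 2+q≡2^d+t ⟨
      2 + q                            ∎))
      where open ≤-Reasoning

    q<leafCount+2^ : ∀ u {s} → length u ≡ d → length u ≤ s → q < leafCount (mountains 0 u) + 2 ^ s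
    q<leafCount+2^ u {s} len-u u≤s = s≤s⁻¹ (≤-trans (n≤1+n _) (begin-strict
      2 + q                                    ≡⟨ 2+q≡2^d+t ⟩
      2 ^ d + t                                <⟨ +-monoʳ-< (2 ^ d) t<2^d ⟩
      2 ^ d + 2 ^ d                            ≤⟨ +-mono-≤ (m≤m+n (2 ^ d) (val u)) d≤s ⟩
      2 ^ d + val u + 2 ^ s                    ≡⟨ cong (_+ 2 ^ s) (suc-leafCount u len-u) ⟨
      suc (leafCount (mountains 0 u) + 2 ^ s)  ∎))
      where
      open ≤-Reasoning
      d≤s : 2 ^ d ≤ 2 ^ s
      d≤s = ^-monoʳ-≤ 2 (subst (_≤ s) len-u u≤s)

    leafCount≤q : ∀ w → length w ≡ e → leafCount (mountains 0 w) ≤ q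
    leafCount≤q w len-w = s≤s⁻¹ (s≤s⁻¹ (begin
      2 + leafCount (mountains 0 w)  ≡⟨ cong suc (suc-leafCount w len-w) ⟩
      suc (X + val w)                ≤⟨ +-monoʳ-< X (subst (λ l → val w < 2 ^ l) len-w (val<2^length w)) ⟩
      X + X                          ≡⟨ cong (_+_ X) (+-identityʳ X) ⟨
      2 ^ d                          ≤⟨ m≤m+n (2 ^ d) t ⟩
      2 ^ d + t                      ≡⟨ 2+q≡2^d+t ⟨
      2 + q                          ∎))
      where open ≤-Reasoning

  leafHeight-∷ʳ : ∀ u x → length u ≡ d →
    leafHeight q (u ∷ʳ x) ≡ threshold t (leafHeight q u) (bit x + d) (val u)
  leafHeight-∷ʳ u x len-u with t ≤? val u
  ... | yes t≤u = begin
    heightFromRight q (mountains 0 (u ∷ʳ x))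
      ≡⟨ cong (heightFromRight q) (mountains-∷ʳ u x) ⟩
    heightFromRight q (mountains 0 u ++ (bit x + length u) ∷ [])
      ≡⟨ heightFromRight-++ˡ (mountains 0 u) _ (t≤val⇒q<leafCount u len-u t≤u) ⟩
    leafHeight q u
      ≡⟨ threshold-≥ (leafHeight q u) (bit x + d) t≤u ⟨
    threshold t (leafHeight q u) (bit x + d) (val u)
      ∎
    where open ≡-Reasoning
  ... | no  t≰u = begin
    heightFromRight q (mountains 0 (u ∷ʳ x))
      ≡⟨ cong (heightFromRight q) (mountains-∷ʳ u x) ⟩
    heightFromRight q (mountains 0 u ++ (bit x + length u) ∷ [])
      ≡⟨ heightFromRight-∷ʳ (mountains 0 u) _ (val<t⇒leafCount≤q u len-u (≰⇒> t≰u))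
                                              (q<leafCount+2^ u len-u (m≤n+m (length u) (bit x))) ⟩
    bit x + length u
      ≡⟨ cong (_+_ (bit x)) len-u ⟩
    bit x + d
      ≡⟨ threshold-< (leafHeight q u) (bit x + d) (≰⇒> t≰u) ⟨
    threshold t (leafHeight q u) (bit x + d) (val u)
      ∎
    where open ≡-Reasoning

  leafHeight-∷ʳ-top : ∀ w c → length w ≡ e → t ≤ val (w ∷ʳ c) →
    leafHeight q (w ∷ʳ c) ≡ bit c + e
  leafHeight-∷ʳ-top w c len-w t≤wc = begin
    heightFromRight q (mountains 0 (w ∷ʳ c))
      ≡⟨ cong (heightFromRight q) (mountains-∷ʳ w c) ⟩
    heightFromRight q (mountains 0 w ++ (bit c + length w) ∷ [])
      ≡⟨ heightFromRight-∷ʳ (mountains 0 w) _ (leafCount≤q w len-w) q<wc ⟩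
    bit c + length w
      ≡⟨ cong (_+_ (bit c)) len-w ⟩
    bit c + e
      ∎
    where
    open ≡-Reasoning
    len-wc : length (w ∷ʳ c) ≡ d
    len-wc = trans (length-++ w) (trans (+-comm (length w) 1) (cong suc len-w))
    q<wc : q < leafCount (mountains 0 w) + 2 ^ (bit c + length w)
    q<wc = subst (q <_) (trans (cong leafCount (mountains-∷ʳ w c)) (leafCount-∷ʳ (mountains 0 w) _))
                 (t≤val⇒q<leafCount (w ∷ʳ c) len-wc t≤wc)

  ∑Vectors-leafHeight : ∑Vectors (suc d) (leafHeight q) ≡ periodSum e t
  ∑Vectors-leafHeight = begin
    ∑Vectors (suc d) (leafHeight q)
      ≡⟨ ∑Vectors-∷ʳ d (leafHeight q) ⟩
    ∑Vectors d (λ u → leafHeight q (u ∷ʳ false) + leafHeight q (u ∷ʳ true))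
      ≡⟨ ∑Vectors-cong d (λ u len-u → trans
           (cong₂ _+_ (leafHeight-∷ʳ u false len-u) (leafHeight-∷ʳ u true len-u))
           (threshold-+ t _ d _ (suc d) (val u))) ⟩
    ∑Vectors d (λ u → pair (leafHeight q u) (val u))
      ≡⟨ ∑Vectors-∷ʳ e (λ u → pair (leafHeight q u) (val u)) ⟩
    ∑Vectors e (λ w → pair (leafHeight q (w ∷ʳ false)) (val (w ∷ʳ false))
                    + pair (leafHeight q (w ∷ʳ true)) (val (w ∷ʳ true)))
      ≡⟨ ∑Vectors-cong e (λ w len-w → cong₂ _+_
           (top w false len-w)
           (trans (top w true len-w) (cong (λ y → pair d (y + val w)) (*-identityˡ X)))) ⟩
    ∑Vectors e (λ w → pair e (val w) + pair d (X + val w))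
      ≡⟨ ∑Vectors-val e (λ v → pair e v + pair d (X + v)) ⟩
    periodSum e t
      ∎
    where
    open ≡-Reasoning
    pair : ℕ → ℕ → ℕ
    pair = heightPair d t
    top : ∀ w c → length w ≡ e →
      pair (leafHeight q (w ∷ʳ c)) (val (w ∷ʳ c)) ≡ pair (bit c + e) (bit c * X + val w)
    top w c len-w = trans
      (threshold-cong (d + suc d) (λ t≤wc → cong (λ g → g + g) (leafHeight-∷ʳ-top w c len-w t≤wc)))
      (cong (pair (bit c + e)) (trans (val-∷ʳ w c) (cong (λ l → bit c * 2 ^ l + val w) len-w)))

σ-CesaroLimit : ∀ q e t → 2 + q ≡ 2 ^ suc e + t → t < 2 ^ suc e →
  CesaroLimit (λ i → σ (suc q) (suc q + i)) (periodSum e t /2^ (2 + e))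
σ-CesaroLimit q e t 2+q≡2^d+t t<2^d =
  subst (CesaroLimit f) (cong (λ S → (+ S) ℚ./ P) window≡periodSum)
    (eventually-periodic⇒CesaroLimit f P i₀ periodic)
  where
  D = 2 + e
  P = 2 ^ D
  instance
    P≢0 : NonZero P
    P≢0 = m^n≢0 2 D
  f : ℕ → ℕ
  f i = σ (suc q) (suc q + i)
  1+q<P : suc q < P
  1+q<P = <⇒≤ $ begin-strict
    2 + q                  ≡⟨ 2+q≡2^d+t ⟩
    2 ^ suc e + t          <⟨ +-monoʳ-< (2 ^ suc e) t<2^d ⟩
    2 ^ suc e + 2 ^ suc e  ≡⟨ cong (_+_ (2 ^ suc e)) (+-identityʳ (2 ^ suc e)) ⟨
    P                      ∎
    where open ≤-Reasoning
  -- The window starts at k + i₀ = 2^D − 1, the numeral 1…1 with D digits, so along the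
  -- window the lowest D digits run through all D-digit vectors.
  i₀ = repunit D ∸ suc q
  1+q+i₀≡repunit : suc q + i₀ ≡ repunit D
  1+q+i₀≡repunit = m+[n∸m]≡n (s≤s⁻¹ (subst (suc (suc q) ≤_) (sym (suc-repunit D)) 1+q<P))
  periodic : ∀ i → i₀ ≤ i → f (i + P) ≡ f i
  periodic i i₀≤i = trans (cong (σ (suc q)) (rearrange (suc q) i P)) (σ-2^+ q D (suc q + i) 1+q<P repunit≤1+q+i)
    where
    rearrange : ∀ k i P → k + (i + P) ≡ P + (k + i)
    rearrange = solve-∀
    repunit≤1+q+i : repunit D ≤ suc q + i
    repunit≤1+q+i = subst (_≤ suc q + i) 1+q+i₀≡repunit (+-monoʳ-≤ (suc q) i₀≤i)
  term : ∀ j → f (i₀ + j) ≡ leafHeight q (take D (fold (replicate D false) increment j))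
  term j = begin
    σ (suc q) (suc q + (i₀ + j))
      ≡⟨ cong (σ (suc q)) (trans (sym (+-assoc (suc q) i₀ j))
                                 (trans (cong (_+ j) 1+q+i₀≡repunit) (+-comm (repunit D) j))) ⟩
    σ (suc q) (j + repunit D)
      ≡⟨ σ≡leafHeight-take q D (j + repunit D) 1+q<P (length-digits D _ (m≤n+m (repunit D) j)) ⟩
    leafHeight q (take D (digits (j + repunit D)))
      ≡⟨ cong (leafHeight q ∘ take D) (fold-+ [] increment j) ⟩
    leafHeight q (take D (fold (digits (repunit D)) increment j))
      ≡⟨ cong (λ bs → leafHeight q (take D (fold bs increment j))) (digits-repunit D) ⟩
    leafHeight q (take D (fold (replicate D false) increment j))
      ∎
    where open ≡-Reasoning
  window≡periodSum : ∑ (λ j → f (i₀ + j)) P ≡ periodSum e t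
  window≡periodSum = begin
    ∑ (λ j → f (i₀ + j)) P
      ≡⟨ ∑-cong P (λ j _ → term j) ⟩
    ∑ (λ j → leafHeight q (take D (fold (replicate D false) increment j))) P
      ≡⟨ ∑-take-fold-increment D (leafHeight q) ⟩
    ∑Vectors D (leafHeight q)
      ≡⟨ LeafPosition.∑Vectors-leafHeight q e t 2+q≡2^d+t t<2^d ⟩
    periodSum e t
      ∎
    where open ≡-Reasoning

amortized-σ-low : ∀ q d → 2 ^ d ≤ suc q + 1 → 2 * (suc q + 1) < 3 * 2 ^ d →
  CesaroLimit (λ i → σ (suc q) (suc q + i)) (((d /2^ 0) +ℚ ((3 * (suc q + 1)) /2^ suc d)) - (2 /2^ 0))
amortized-σ-low q zero _ 2[k+1]<3 =
  contradiction 2[k+1]<3 (≤⇒≯ (≤-trans (n≤1+n 3) (*-monoʳ-≤ 2 (s≤s (m≤n+m 1 q)))))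
amortized-σ-low q (suc e) 2^d≤k+1 2[k+1]<3·2^d =
  subst (CesaroLimit (λ i → σ (suc q) (suc q + i)))
    (sym (/2^-affine (suc e) (3 * (suc q + 1)) 2 (periodSum e t) 0 (2 + e) affine))
    (σ-CesaroLimit q e t (trans (cong suc (+-comm 1 q)) k+1≡2X+t) (<-≤-trans t<X (m≤m+n X (X + 0))))
  where
  X = 2 ^ e
  t = suc q + 1 ∸ 2 * X
  k+1≡2X+t : suc q + 1 ≡ 2 * X + t
  k+1≡2X+t = sym (m+[n∸m]≡n 2^d≤k+1)
  t<X : t < X
  t<X = *-cancelˡ-< 2 t X (+-cancelˡ-< (2 * (2 * X)) (2 * t) (2 * X) (subst₂ _<_
          (trans (cong (2 *_) k+1≡2X+t) (*-distribˡ-+ 2 (2 * X) t)) (3*2X≡ X) 2[k+1]<3·2^d))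
    where
    3*2X≡ : ∀ X → 3 * (2 * X) ≡ 2 * (2 * X) + 2 * X
    3*2X≡ = solve-∀
  r = X ∸ t
  t+r≡X : t + r ≡ X
  t+r≡X = m+[n∸m]≡n (<⇒≤ t<X)
  affine : suc e * 2 ^ (2 + e) + 3 * (suc q + 1) ≡ periodSum e t + 2 * 2 ^ (2 + e)
  affine = begin
    suc e * 2 ^ (2 + e) + 3 * (suc q + 1)
      ≡⟨ cong (λ k+1 → suc e * 2 ^ (2 + e) + 3 * k+1) k+1≡2X+t ⟩
    suc e * (2 * (2 * X)) + 3 * (2 * X + t)
      ≡⟨ cong (λ x → suc e * (2 * (2 * x)) + 3 * (2 * x + t)) t+r≡X ⟨
    suc e * (2 * (2 * (t + r))) + 3 * (2 * (t + r) + t)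
      ≡⟨ count e t r ⟩
    t * (suc e + suc (suc e)) + r * (e + e) + (t + r) * (suc e + suc e) + 2 * (2 * (2 * (t + r)))
      ≡⟨ cong (λ x → t * (suc e + suc (suc e)) + r * (e + e) + x * (suc e + suc e) + 2 * (2 * (2 * x))) t+r≡X ⟩
    t * (suc e + suc (suc e)) + r * (e + e) + X * (suc e + suc e) + 2 * 2 ^ (2 + e)
      ≡⟨ cong (_+ 2 * 2 ^ (2 + e)) (periodSum-low e t r t+r≡X) ⟨
    periodSum e t + 2 * 2 ^ (2 + e)
      ∎
    where
    open ≡-Reasoning
    count : ∀ e t r → suc e * (2 * (2 * (t + r))) + 3 * (2 * (t + r) + t) ≡
      t * (suc e + suc (suc e)) + r * (e + e) + (t + r) * (suc e + suc e) + 2 * (2 * (2 * (t + r)))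
    count = solve-∀

amortized-σ-high : ∀ q d → 3 * 2 ^ d ≤ 2 * (suc q + 1) → suc q + 1 < 2 ^ suc d →
  CesaroLimit (λ i → σ (suc q) (suc q + i)) (((d /2^ 0) +ℚ ((suc q + 1) /2^ suc d)) - (1 /2^ 1))
amortized-σ-high q zero _ k+1<2 = contradiction k+1<2 (≤⇒≯ (s≤s (m≤n+m 1 q)))
amortized-σ-high q (suc e) 3·2^d≤2[k+1] k+1<2^[d+1] =
  subst (CesaroLimit (λ i → σ (suc q) (suc q + i)))
    (sym (/2^-affine (suc e) (suc q + 1) 1 (periodSum e (X + t′)) 1 (suc e) affine))
    (σ-CesaroLimit q e (X + t′) (trans (cong suc (+-comm 1 q)) (trans k+1≡3X+t′ (split X t′))) X+t′<2X)
  where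
  X = 2 ^ e
  3X≤k+1 : 3 * X ≤ suc q + 1
  3X≤k+1 = *-cancelˡ-≤ 2 (subst (_≤ 2 * (suc q + 1)) (swap X) 3·2^d≤2[k+1])
    where
    swap : ∀ X → 3 * (2 * X) ≡ 2 * (3 * X)
    swap = solve-∀
  t′ = suc q + 1 ∸ 3 * X
  k+1≡3X+t′ : suc q + 1 ≡ 3 * X + t′
  k+1≡3X+t′ = sym (m+[n∸m]≡n 3X≤k+1)
  split : ∀ X t′ → 3 * X + t′ ≡ 2 * X + (X + t′)
  split = solve-∀
  t′<X : t′ < X
  t′<X = +-cancelˡ-< (3 * X) t′ X (subst₂ _<_ k+1≡3X+t′ (4X≡ X) k+1<2^[d+1])
    where
    4X≡ : ∀ X → 2 * (2 * X) ≡ 3 * X + X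
    4X≡ = solve-∀
  X+t′<2X : X + t′ < 2 * X
  X+t′<2X = subst (X + t′ <_) (cong (_+_ X) (sym (+-identityʳ X))) (+-monoʳ-< X t′<X)
  r = X ∸ t′
  t′+r≡X : t′ + r ≡ X
  t′+r≡X = m+[n∸m]≡n (<⇒≤ t′<X)
  affine : suc e * 2 ^ (1 + suc e) + (suc q + 1) ≡ periodSum e (X + t′) + 1 * 2 ^ suc e
  affine = begin
    suc e * 2 ^ (1 + suc e) + (suc q + 1)
      ≡⟨ cong (λ k+1 → suc e * 2 ^ (1 + suc e) + k+1) k+1≡3X+t′ ⟩
    suc e * (2 * (2 * X)) + (3 * X + t′)
      ≡⟨ cong (λ x → suc e * (2 * (2 * x)) + (3 * x + t′)) t′+r≡X ⟨
    suc e * (2 * (2 * (t′ + r))) + (3 * (t′ + r) + t′)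
      ≡⟨ count e t′ r ⟩
    (t′ + r) * (suc e + suc (suc e)) + (t′ * (suc e + suc (suc e)) + r * (suc e + suc e)) + 1 * (2 * (t′ + r))
      ≡⟨ cong (λ x → x * (suc e + suc (suc e)) + (t′ * (suc e + suc (suc e)) + r * (suc e + suc e)) + 1 * (2 * x))
              t′+r≡X ⟩
    X * (suc e + suc (suc e)) + (t′ * (suc e + suc (suc e)) + r * (suc e + suc e)) + 1 * 2 ^ suc e
      ≡⟨ cong (_+ 1 * 2 ^ suc e) (periodSum-high e t′ r t′+r≡X) ⟨
    periodSum e (X + t′) + 1 * 2 ^ suc e
      ∎
    where
    open ≡-Reasoning
    count : ∀ e t′ r → suc e * (2 * (2 * (t′ + r))) + (3 * (t′ + r) + t′) ≡
      (t′ + r) * (suc e + suc (suc e)) + (t′ * (suc e + suc (suc e)) + r * (suc e + suc e)) + 1 * (2 * (t′ + r))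
    count = solve-∀

lemma25 : ∀ (k : ℕ) → 1 ≤ k →
    ((2 ^ ⌊log₂ (k + 1) ⌋ ≤ k + 1 × 2 * (k + 1) < 3 * 2 ^ ⌊log₂ (k + 1) ⌋) →
      CesaroLimit (λ i → σ k (k + i))
        (((⌊log₂ (k + 1) ⌋ /2^ 0) +ℚ ((3 * (k + 1)) /2^ suc ⌊log₂ (k + 1) ⌋)) - (2 /2^ 0)))
    × ((3 * 2 ^ ⌊log₂ (k + 1) ⌋ ≤ 2 * (k + 1) × k + 1 < 2 ^ suc ⌊log₂ (k + 1) ⌋) →
      CesaroLimit (λ i → σ k (k + i))
        (((⌊log₂ (k + 1) ⌋ /2^ 0) +ℚ ((k + 1) /2^ suc ⌊log₂ (k + 1) ⌋)) - (1 /2^ 1)))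
lemma25 (suc q) _ =
  (λ (lower , upper) → amortized-σ-low q ⌊log₂ (suc q + 1) ⌋ lower upper) ,
  (λ (lower , upper) → amortized-σ-high q ⌊log₂ (suc q + 1) ⌋ lower upper)
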